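{- Let $j$ be a positive integer, $C(n)=\sum_{i=0}^{j-1}\left\lceil \frac{n-i}{2j}\right\rceil$ for $n\in\mathbb{Z}$, and for $y=(s_1,a_1,s_2,a_2)\in\mathbb{Z}^4$ and $n\in\mathbb{Z}$ let $h(n,y)=C(n-s_1-C(n-a_1))+C(n-s_2-C(n-a_2))-C(n)$. Let $\sim$ be the equivalence relation on $\mathbb{Z}^4$ generated by: $(s_1,a_1,s_2,a_2)\sim(s_1+cj,a_1+2cj,s_2,a_2)$, $(s_1,a_1,s_2,a_2)\sim(s_1,a_1,s_2+dj,a_2+2dj)$, and $(s_1,a_1,s_2,a_2)\sim(s_1-2ej,a_1,s_2+2ej,a_2)$ for all $c,d,e\in\mathbb{Z}$. If $y\sim y'$, then $h(n,y)=h(n,y')$ for all $n\in\mathbb{Z}$. -}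

module Defs where

open import Data.Nat as ℕ using (ℕ; suc; NonZero)
open import Data.Nat.Properties using (m*n≢0)
open import Data.Integer using (ℤ; +_; _+_; _-_; -_; _*_; 0ℤ)
open import Data.Integer.DivMod using (_/ℕ_)
open import Data.List using (List; foldr; map; upTo)
open import Data.Product using (_×_; _,_)
open import Relation.Binary.Construct.Closure.Equivalence using (EqClosure)

-- ceiling of x / m for a positive natural m: ⌈x/m⌉ = - ⌊(-x)/m⌋
-- (_/ℕ_ is floor division since its remainder is always nonnegative)
⌈_/_⌉ : ℤ → (m : ℕ) → .{{NonZero m}} → ℤ
⌈ x / m ⌉ = - ((- x) /ℕ m)

sumℤ : List ℤ → ℤ
sumℤ = foldr _+_ 0ℤ

C : (j : ℕ) → .{{NonZero j}} → ℤ → ℤ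
C j n = sumℤ (map (λ i → ⌈ n - + i / 2 ℕ.* j ⌉ {{m*n≢0 2 j}}) (upTo j))

ℤ⁴ : Set
ℤ⁴ = ℤ × ℤ × ℤ × ℤ

h : (j : ℕ) → .{{NonZero j}} → ℤ → ℤ⁴ → ℤ
h j n (s₁ , a₁ , s₂ , a₂) =
  C j (n - s₁ - C j (n - a₁)) + C j (n - s₂ - C j (n - a₂)) - C j n

data Step (j : ℕ) : ℤ⁴ → ℤ⁴ → Set where
  move₁ : ∀ s₁ a₁ s₂ a₂ (c : ℤ) →
          Step j (s₁ , a₁ , s₂ , a₂) (s₁ + c * + j , a₁ + + 2 * c * + j , s₂ , a₂)
  move₂ : ∀ s₁ a₁ s₂ a₂ (d : ℤ) →
          Step j (s₁ , a₁ , s₂ , a₂) (s₁ , a₁ , s₂ + d * + j , a₂ + + 2 * d * + j)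
  move₃ : ∀ s₁ a₁ s₂ a₂ (e : ℤ) →
          Step j (s₁ , a₁ , s₂ , a₂) (s₁ - + 2 * e * + j , a₁ , s₂ + + 2 * e * + j , a₂)

_∼⟨_⟩_ : ℤ⁴ → ℕ → ℤ⁴ → Set
y ∼⟨ j ⟩ y' = EqClosure (Step j) y y'

-- Shifting x by a multiple k·2j shifts each ⌈(x − i)/2j⌉ by k, so
-- C(x + 2jk) = C(x) + jk. Under move₁ the inner argument n − a₁ drops by 2cj,
-- so C(n − a₁) drops by cj and exactly compensates the shift s₁ ↦ s₁ + cj;
-- move₂ is symmetric. Under move₃ the two outer arguments change by ±2ej, so
-- the two outer C-values change by ±ej and cancel.
module Submission where

open import Defs
open import Data.Nat as ℕ using (ℕ; NonZero)
open import Data.Nat.Properties using (m*n≢0)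
open import Data.Integer using (ℤ; +_; _+_; _-_; -_; _*_; 0ℤ; _≤_; _<_; suc)
open import Data.Integer.Properties
open import Data.Integer.DivMod using (_/ℕ_; [n/ℕd]*d≤n; n<s[n/ℕd]*d)
open import Data.Integer.Tactic.RingSolver using (solve-∀)
open import Data.List using (List; []; _∷_; map; upTo; length)
open import Data.List.Properties using (map-cong; length-upTo)
open import Relation.Binary.PropositionalEquality
open import Relation.Binary.Construct.Closure.Equivalence using (gfold)
open import Data.Empty using (⊥)

/ℕ-unique : ∀ a m .{{_ : NonZero m}} (q : ℤ) →
            q * + m ≤ a → a < suc q * + m → a /ℕ m ≡ q
/ℕ-unique a m q q*m≤a a<[1+q]*m =
  ≤-antisym (≮⇒≥ q≮⌊a/m⌋) (≮⇒≥ ⌊a/m⌋≮q)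
  where
  q≮⌊a/m⌋ : q < a /ℕ m → ⊥
  q≮⌊a/m⌋ q<⌊a/m⌋ = <⇒≱ a<[1+q]*m
    (≤-trans (*-monoʳ-≤-nonNeg (+ m) (i<j⇒suc[i]≤j q<⌊a/m⌋)) ([n/ℕd]*d≤n a m))
  ⌊a/m⌋≮q : a /ℕ m < q → ⊥
  ⌊a/m⌋≮q ⌊a/m⌋<q = <⇒≱ (n<s[n/ℕd]*d a m)
    (≤-trans (*-monoʳ-≤-nonNeg (+ m) (i<j⇒suc[i]≤j ⌊a/m⌋<q)) q*m≤a)

[a+k*m]/ℕm≡a/ℕm+k : ∀ a m .{{_ : NonZero m}} (k : ℤ) → (a + k * + m) /ℕ m ≡ a /ℕ m + k
[a+k*m]/ℕm≡a/ℕm+k a m k = /ℕ-unique (a + k * + m) m (q + k) lower upper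
  where
  q : ℤ
  q = a /ℕ m
  suc-distrib : ∀ q k m → (+ 1 + (q + k)) * m ≡ (+ 1 + q) * m + k * m
  suc-distrib = solve-∀
  lower : (q + k) * + m ≤ a + k * + m
  lower = subst (_≤ a + k * + m) (sym (*-distribʳ-+ (+ m) q k))
                (+-monoˡ-≤ (k * + m) ([n/ℕd]*d≤n a m))
  upper : a + k * + m < suc (q + k) * + m
  upper = subst (a + k * + m <_) (sym (suc-distrib q k (+ m)))
                (+-monoˡ-< (k * + m) (n<s[n/ℕd]*d a m))

⌈x+k*m/m⌉≡⌈x/m⌉+k : ∀ x m .{{_ : NonZero m}} (k : ℤ) → ⌈ x + k * + m / m ⌉ ≡ ⌈ x / m ⌉ + k
⌈x+k*m/m⌉≡⌈x/m⌉+k x m k = begin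
  - ((- (x + k * + m)) /ℕ m)    ≡⟨ cong (λ z → - (z /ℕ m)) (neg-shift x k (+ m)) ⟩
  - ((- x + (- k) * + m) /ℕ m)  ≡⟨ cong -_ ([a+k*m]/ℕm≡a/ℕm+k (- x) m (- k)) ⟩
  - ((- x) /ℕ m + - k)          ≡⟨ neg-involutive-shift ((- x) /ℕ m) k ⟩
  ⌈ x / m ⌉ + k                 ∎
  where
  open ≡-Reasoning
  neg-shift : ∀ x k m → - (x + k * m) ≡ - x + (- k) * m
  neg-shift = solve-∀
  neg-involutive-shift : ∀ a k → - (a + - k) ≡ - a + k
  neg-involutive-shift = solve-∀

sumℤ-map-+ : (f : ℕ → ℤ) (k : ℤ) (l : List ℕ) →
             sumℤ (map (λ i → f i + k) l) ≡ sumℤ (map f l) + + length l * k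
sumℤ-map-+ f k []      = sym (+-identityʳ 0ℤ)
sumℤ-map-+ f k (i ∷ l) = begin
  (f i + k) + sumℤ (map (λ i → f i + k) l)  ≡⟨ cong (λ z → (f i + k) + z) (sumℤ-map-+ f k l) ⟩
  (f i + k) + (S + + length l * k)          ≡⟨ regroup (f i) S k (+ length l * k) ⟩
  (f i + S) + (k + + length l * k)          ≡⟨ cong (λ z → (f i + S) + z) (suc-* (+ length l) k) ⟨
  (f i + S) + + ℕ.suc (length l) * k        ∎
  where
  open ≡-Reasoning
  S : ℤ
  S = sumℤ (map f l)
  regroup : ∀ a b c d → (a + c) + (b + d) ≡ (a + b) + (c + d)
  regroup = solve-∀

C-quasiperiodic : ∀ j .{{_ : NonZero j}} x k → C j (x + k * (+ 2 * + j)) ≡ C j x + + j * k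
C-quasiperiodic j x k = begin
  C j (x + k * (+ 2 * + j))
    ≡⟨ cong sumℤ (map-cong term-shift (upTo j)) ⟩
  sumℤ (map (λ i → ⌈ x - + i / 2j ⌉ {{2j≢0}} + k) (upTo j))
    ≡⟨ sumℤ-map-+ (λ i → ⌈ x - + i / 2j ⌉ {{2j≢0}}) k (upTo j) ⟩
  C j x + + length (upTo j) * k
    ≡⟨ cong (λ L → C j x + + L * k) (length-upTo j) ⟩
  C j x + + j * k
    ∎
  where
  open ≡-Reasoning
  2j : ℕ
  2j = 2 ℕ.* j
  2j≢0 : NonZero 2j
  2j≢0 = m*n≢0 2 j
  reassociate : ∀ x k M i → (x + k * M) - i ≡ (x - i) + k * M
  reassociate = solve-∀
  term-shift : ∀ i → ⌈ (x + k * (+ 2 * + j)) - + i / 2j ⌉ {{2j≢0}}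
                   ≡ ⌈ x - + i / 2j ⌉ {{2j≢0}} + k
  term-shift i = begin
    ⌈ (x + k * (+ 2 * + j)) - + i / 2j ⌉ {{2j≢0}}
      ≡⟨ cong (λ z → ⌈ z / 2j ⌉ {{2j≢0}}) (reassociate x k (+ 2 * + j) (+ i)) ⟩
    ⌈ (x - + i) + k * (+ 2 * + j) / 2j ⌉ {{2j≢0}}
      ≡⟨ cong (λ M → ⌈ (x - + i) + k * M / 2j ⌉ {{2j≢0}}) (pos-* 2 j) ⟨
    ⌈ (x - + i) + k * + 2j / 2j ⌉ {{2j≢0}}
      ≡⟨ ⌈x+k*m/m⌉≡⌈x/m⌉+k (x - + i) 2j {{2j≢0}} k ⟩
    ⌈ x - + i / 2j ⌉ {{2j≢0}} + k
      ∎

inner-argument-invariant : ∀ j .{{_ : NonZero j}} n s a c →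
  n - (s + c * + j) - C j (n - (a + + 2 * c * + j)) ≡ n - s - C j (n - a)
inner-argument-invariant j n s a c = begin
  n - (s + c * + j) - C j (n - (a + + 2 * c * + j))
    ≡⟨ cong (λ z → n - (s + c * + j) - C j z) (move-multiple n a c (+ j)) ⟩
  n - (s + c * + j) - C j ((n - a) + (- c) * (+ 2 * + j))
    ≡⟨ cong (λ z → n - (s + c * + j) - z) (C-quasiperiodic j (n - a) (- c)) ⟩
  n - (s + c * + j) - (C j (n - a) + + j * (- c))
    ≡⟨ cancel n s c (+ j) (C j (n - a)) ⟩
  n - s - C j (n - a)
    ∎
  where
  open ≡-Reasoning
  move-multiple : ∀ n a c J → n - (a + + 2 * c * J) ≡ (n - a) + (- c) * (+ 2 * J)
  move-multiple = solve-∀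
  cancel : ∀ n s c J A → n - (s + c * J) - (A + J * (- c)) ≡ n - s - A
  cancel = solve-∀

h-step-invariant : ∀ j .{{_ : NonZero j}} n {y y'} → Step j y y' → h j n y ≡ h j n y'
h-step-invariant j n (move₁ s₁ a₁ s₂ a₂ c) =
  cong (λ z → C j z + C j (n - s₂ - C j (n - a₂)) - C j n)
       (sym (inner-argument-invariant j n s₁ a₁ c))
h-step-invariant j n (move₂ s₁ a₁ s₂ a₂ d) =
  cong (λ z → C j (n - s₁ - C j (n - a₁)) + C j z - C j n)
       (sym (inner-argument-invariant j n s₂ a₂ d))
h-step-invariant j n (move₃ s₁ a₁ s₂ a₂ e) = begin
  C j X + C j Y - C j n
    ≡⟨ cancel (C j X) (C j Y) (+ j) e (C j n) ⟨
  (C j X + + j * e) + (C j Y + + j * (- e)) - C j n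
    ≡⟨ cong₂ (λ u v → u + v - C j n) (C-quasiperiodic j X e) (C-quasiperiodic j Y (- e)) ⟨
  C j (X + e * (+ 2 * + j)) + C j (Y + (- e) * (+ 2 * + j)) - C j n
    ≡⟨ cong₂ (λ u v → C j u + C j v - C j n)
             (shift-left n s₁ e (+ j) (C j (n - a₁))) (shift-right n s₂ e (+ j) (C j (n - a₂))) ⟨
  C j (n - (s₁ - + 2 * e * + j) - C j (n - a₁)) + C j (n - (s₂ + + 2 * e * + j) - C j (n - a₂))
    - C j n
    ∎
  where
  open ≡-Reasoning
  X Y : ℤ
  X = n - s₁ - C j (n - a₁)
  Y = n - s₂ - C j (n - a₂)
  shift-left : ∀ n s e J A → n - (s - + 2 * e * J) - A ≡ (n - s - A) + e * (+ 2 * J)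
  shift-left = solve-∀
  shift-right : ∀ n s e J A → n - (s + + 2 * e * J) - A ≡ (n - s - A) + (- e) * (+ 2 * J)
  shift-right = solve-∀
  cancel : ∀ X Y J e Z → X + J * e + (Y + J * (- e)) - Z ≡ X + Y - Z
  cancel = solve-∀

mainTheorem7 : (j : ℕ) → .{{_ : NonZero j}} → (y y' : ℤ⁴) → y ∼⟨ j ⟩ y' → (n : ℤ) → h j n y ≡ h j n y'
mainTheorem7 j y y' y∼y' n = gfold isEquivalence (h j n) (h-step-invariant j n) y∼y'
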